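{- Let $\mu=(\mu_1,\dots,\mu_p)\vdash n$ and $\gamma=(\gamma_1,\dots,\gamma_p)$ with $0\le\gamma_j\le\mu_j$. Set $t_0=0$ and $t_j=\sum_{i=1}^j(\mu_i-\gamma_i)$, so that \[ \mathrm{st}(J(\mu,\gamma))=(1,2,\dots,t_1,t_1,\dots,t_1\mid t_1+1,\dots,t_2,t_2,\dots,t_2\mid\cdots\mid t_{p-1}+1,\dots,t_p,t_p,\dots,t_p), \] the $j$-th segment having length $\mu_j$ and ending with $\gamma_j$ repeated values. Then \[ \#\mathcal{A}_n(\mu,\gamma)=\prod_{j=1}^p\#\mathcal{I}(\mu_j,\gamma_j,t_{j-1})=\prod_{j=1}^p\#\mathcal{L}(\mu_j,\gamma_j,t_{j-1}). \]
   Context: $M_j=\mu_1+\cdots+\mu_j$; $J(\mu,\gamma)=\bigsqcup_j\{M_j-\gamma_j+1,\dots,M_j\}$. For $J\subseteq[n]$, $\mathrm{st}(J)_1=1$ if $1\notin J$, $0$ if $1\in J$; $\mathrm{st}(J)_i=\mathrm{st}(J)_{i-1}+1$ if $i\notin J$, $=\mathrm{st}(J)_{i-1}$ if $i\in J$. $\mathcal{A}_n(\mu,\gamma)$ is the set of monomials $x_1^{a_1}\cdots x_n^{a_n}$ with $a_i<\mathrm{st}(J(\mu,\gamma))_i$ for all $i$, $a_{M_{j-1}+1}<\cdots<a_{M_j-\gamma_j}$ and $a_{M_j-\gamma_j+1}\le\cdots\le a_{M_j}$ for all $j$. For $m,k,t\ge0$, $k\le m$: $\mathcal{I}(m,k,t)$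 is the set of nonnegative integer sequences $(c_1,\dots,c_m)$ with $c_1<\cdots<c_{m-k}$, $c_{m-k+1}\le\cdots\le c_m$, and $(c_1,\dots,c_m)\le(t,t+1,\dots,t+m-k-1,t+m-k-1,\dots,t+m-k-1)$ componentwise (last value repeated $k$ times); $\#\mathcal{L}(m,k,t)$ is the number of pairs $(\lambda,\nu)$ of partitions with $\nu\subseteq((m-k)^k)$ and $\lambda\subseteq(m^\chi)$, where $\chi=t$ if $\nu_1<m-k$ and $\chi=t-1$ if $\nu_1=m-k$ (here $\nu\subseteq(a^b)$ means at most $b$ parts each at most $a$, none if $b<0$); these pairs index the polynomials $e_\lambda(x_1,\dots,x_m)s_\nu(x_{m-k+1},\dots,x_m)$. -}

module Defs where

open import Data.Nat using (ℕ; zero; suc; _+_; _*_; _∸_; _≤_; _<_; _≥_; _<ᵇ_; _≤ᵇ_)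
open import Data.Bool using (Bool; true; false; if_then_else_; _∧_)
open import Data.Fin using (Fin; toℕ)
open import Data.List using (List; []; _∷_; length; allFin; map)
open import Data.Nat.ListAction using (product)
open import Data.Bool.ListAction using (any)
open import Data.List.Relation.Unary.All using (All)
open import Data.List.Relation.Unary.Linked using (Linked)
open import Data.List.Relation.Unary.Unique.Propositional using (Unique)
open import Data.List.Membership.Propositional using (_∈_)
open import Data.Vec using (Vec; []; _∷_; lookup; zipWith; toList)
open import Data.Product using (Σ; _×_; _,_)
open import Function.Bundles using (_⇔_)
open import Relation.Binary.PropositionalEquality using (_≡_)

HasCard : {A : Set} → (A → Set) → ℕ → Set
HasCard {A} P k =
  Σ (List A) λ xs → Unique xs × (∀ x → (x ∈ xs) ⇔ P x) × (length xs ≡ k)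

-- 1-based reading of a vector: v ! i = v_i for 1 ≤ i ≤ n (0 otherwise;
-- only used in range).

_!_ : {n : ℕ} → Vec ℕ n → ℕ → ℕ
[] ! _ = 0
(x ∷ xs) ! zero = 0
(x ∷ xs) ! suc zero = x
(x ∷ xs) ! suc (suc i) = xs ! suc i

psum : {p : ℕ} → Vec ℕ p → ℕ → ℕ
psum [] _ = 0
psum (x ∷ xs) zero = 0
psum (x ∷ xs) (suc j) = x + psum xs j

prodFin : (p : ℕ) → (Fin p → ℕ) → ℕ
prodFin p f = product (map f (allFin p))

IsPartition : List ℕ → Set
IsPartition xs = Linked _≥_ xs × All (1 ≤_) xs

_⊢_ : {p : ℕ} → Vec ℕ p → ℕ → Set
_⊢_ {p} μ n = IsPartition (toList μ) × (psum μ p ≡ n)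

head0 : List ℕ → ℕ
head0 [] = 0
head0 (x ∷ _) = x

M : {p : ℕ} → Vec ℕ p → ℕ → ℕ
M μ j = psum μ j

tt : {p : ℕ} → Vec ℕ p → Vec ℕ p → ℕ → ℕ
tt μ γ j = psum (zipWith _∸_ μ γ) j

-- J(μ,γ) = ⊔_j {M_j - γ_j + 1, …, M_j}, as a Boolean membership test
-- on positions (1-based); j ranges over Fin p, standing for j+1.
J : {p : ℕ} → Vec ℕ p → Vec ℕ p → ℕ → Bool
J {p} μ γ i =
  any (λ j → ((M μ (suc (toℕ j)) ∸ lookup γ j) <ᵇ i) ∧ (i ≤ᵇ M μ (suc (toℕ j))))
      (allFin p)

-- st(J)_i for i ≥ 1 (st J 0 = 0 is an auxiliary base value):
-- st_1 = 1 if 1 ∉ J, 0 if 1 ∈ J; st_i = st_{i-1} + 1 if i ∉ J, st_{i-1} if i ∈ J.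
st : (ℕ → Bool) → ℕ → ℕ
st Jm zero = 0
st Jm (suc i) = if Jm (suc i) then st Jm i else suc (st Jm i)

-- 𝒜_n(μ,γ): exponent vectors (a_1,…,a_n) of monomials x_1^{a_1}⋯x_n^{a_n}
InA : {p : ℕ} → Vec ℕ p → Vec ℕ p → {n : ℕ} → Vec ℕ n → Set
InA {p} μ γ {n} a =
  (∀ i → 1 ≤ i → i ≤ n → a ! i < st (J μ γ) i)
  × (∀ (j : Fin p) i → suc (M μ (toℕ j)) ≤ i
       → suc i ≤ M μ (suc (toℕ j)) ∸ lookup γ j → a ! i < a ! suc i)
  × (∀ (j : Fin p) i → suc (M μ (suc (toℕ j)) ∸ lookup γ j) ≤ i
       → suc i ≤ M μ (suc (toℕ j)) → a ! i ≤ a ! suc i)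

-- ℐ(m,k,t): sequences (c_1,…,c_m) with c_1<⋯<c_{m-k}, c_{m-k+1}≤⋯≤c_m and
-- c ≤ (t, t+1, …, t+m-k-1, t+m-k-1, …, t+m-k-1) componentwise
-- (c_i ≤ B written as c_i + 1 ≤ B + 1 to avoid truncated subtraction).
InI : (m k t : ℕ) → Vec ℕ m → Set
InI m k t c =
  (∀ i → 1 ≤ i → suc i ≤ m ∸ k → c ! i < c ! suc i)
  × (∀ i → suc (m ∸ k) ≤ i → suc i ≤ m → c ! i ≤ c ! suc i)
  × (∀ i → 1 ≤ i → i ≤ m ∸ k → suc (c ! i) ≤ t + i)
  × (∀ i → suc (m ∸ k) ≤ i → i ≤ m → suc (c ! i) ≤ t + (m ∸ k))

-- ℒ(m,k,t): pairs (λ,ν) of partitions with ν ⊆ ((m-k)^k) and λ ⊆ (m^χ),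
-- χ = t if ν_1 < m-k, χ = t-1 if ν_1 = m-k (no λ at all if χ < 0).
InL : (m k t : ℕ) → List ℕ × List ℕ → Set
InL m k t (lam , nu) =
  IsPartition lam × IsPartition nu
  × length nu ≤ k × All (_≤ m ∸ k) nu
  × All (_≤ m) lam
  × (head0 nu < m ∸ k → length lam ≤ t)
  × (head0 nu ≡ m ∸ k → suc (length lam) ≤ t)

-- On the j-th segment of positions M_{j-1} + r (1 ≤ r ≤ μ_j), st(J(μ,γ)) equals t_{j-1} + min(r, μ_j - γ_j):
-- it grows by one outside J and stays put on the last γ_j positions, which form J's part of the segment.
-- The conditions defining 𝒜ₙ(μ,γ) therefore split into independent conditions on the segments, and the
-- j-th segment ranges exactly over ℐ(μ_j, γ_j, t_{j-1}).  An element of ℐ(m,k,t) is a strictly increasing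
-- (m-k)-sequence with c_i < t + i, counted by C(t+m-k, m-k), next to an unrelated weakly increasing
-- k-sequence below t + m - k; ℒ(m,k,t) splits according to ν₁ < m - k or ν₁ = m - k, and partitions in
-- a box are counted by binomials as well.  The two binomial expressions agree by absorption
-- (a + 1) C(a+b+1, a+1) = (a+b+1) C(a+b, a) and trinomial revision.
module Submission where

open import Defs
open import Data.Nat.ListAction using (product)
open import Data.Nat using (ℕ; zero; suc; _+_; _*_; _∸_; _⊓_; _≤_; _<_; _≥_; _<ᵇ_; _≤ᵇ_; z≤n; s≤s)
open import Data.Nat.Properties
open import Data.List as List using (List; []; _∷_; length; cartesianProduct; allFin)
open import Data.List.Properties as List using (length-map; length-++)
open import Data.List.Relation.Unary.Any as Any using (here; there; satisfied)
open import Data.List.Relation.Unary.Any.Properties using (any⁺; any⁻)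
open import Data.List.Relation.Unary.All as All using (All; []; _∷_)
open import Data.List.Relation.Unary.Linked as Linked using (Linked; []; [-]; _∷_)
open import Data.List.Relation.Unary.Linked.Properties using (Linked⇒All)
open import Data.List.Relation.Unary.AllPairs using ([]; _∷_)
open import Data.List.Relation.Unary.Unique.Propositional.Properties as Unique using ()
open import Data.List.Membership.Propositional using (_∈_)
open import Data.List.Membership.Propositional.Properties
open import Data.Product using (Σ; _×_; _,_; proj₁; proj₂; uncurry)
open import Data.Sum as Sum using (_⊎_; inj₁; inj₂; [_,_]′)
open import Data.Empty using (⊥-elim)
open import Data.Unit using (⊤)
open import Data.Bool using (Bool; true; false; T; _∧_)
open import Data.Bool.Properties using (T-≡; T-∧; ∧-identityʳ)
open import Data.Bool.ListAction using (any)
open import Data.Fin using (Fin; toℕ; fromℕ<) renaming (zero to fzero; suc to fsuc)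
open import Data.Fin.Properties using (toℕ-injective; toℕ-fromℕ<; toℕ<n; ∀-cons)
open import Data.Vec using (Vec; []; _∷_; _++_; splitAt; lookup; zipWith)
open import Data.Vec.Relation.Unary.All.Properties using (lookup⁺; toList⁻)
open import Data.Vec.Properties using (∷-injectiveʳ; ++-injective; lookup-zipWith)
open import Function.Base using (_∘_; id; case_of_)
open import Function.Bundles using (_⇔_; mk⇔; Equivalence)
open import Function.Properties.Equivalence using () renaming (refl to ⇔-refl; sym to ⇔-sym; trans to ⇔-trans)
open import Data.Product.Function.NonDependent.Propositional using (_×-⇔_)
open import Relation.Nullary using (¬_)
open import Relation.Binary.Definitions using (tri<; tri≈; tri>)
open import Relation.Binary.PropositionalEquality hiding (J)
open import Data.Nat.Tactic.RingSolver using (solve-∀)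

open Equivalence using (to; from)
open ≡-Reasoning

HasCard-resp : {A : Set} {P Q : A → Set} {k : ℕ} → (∀ x → P x ⇔ Q x) → HasCard P k → HasCard Q k
HasCard-resp P⇔Q (xs , uniq , ∈⇔P , len) =
  xs , uniq , (λ x → ⇔-trans (∈⇔P x) (P⇔Q x)) , len

HasCard-∅ : {A : Set} {P : A → Set} → (∀ x → ¬ P x) → HasCard P 0
HasCard-∅ ¬P = [] , [] , (λ x → mk⇔ (λ ()) (⊥-elim ∘ ¬P x)) , refl

HasCard-singleton : {A : Set} (a : A) → HasCard (_≡ a) 1
HasCard-singleton a = a ∷ [] , [] ∷ [] , (λ x → mk⇔ (λ { (here x≡a) → x≡a ; (there ()) }) here) , refl

HasCard-⊎ : {A : Set} {P Q : A → Set} {k l : ℕ} → (∀ x → P x → ¬ Q x) →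
  HasCard P k → HasCard Q l → HasCard (λ x → P x ⊎ Q x) (k + l)
HasCard-⊎ {P = P} {Q} disjoint (xs , uxs , ∈xs , lxs) (ys , uys , ∈ys , lys) =
  xs List.++ ys ,
  Unique.++⁺ uxs uys (λ {x} (x∈xs , x∈ys) → disjoint x (to (∈xs x) x∈xs) (to (∈ys x) x∈ys)) ,
  (λ x → mk⇔ (∈⇒P⊎Q x ∘ ∈-++⁻ xs) (P⊎Q⇒∈ x)) ,
  trans (length-++ xs) (cong₂ _+_ lxs lys)
  where
  ∈⇒P⊎Q : ∀ x → x ∈ xs ⊎ x ∈ ys → P x ⊎ Q x
  ∈⇒P⊎Q x (inj₁ x∈xs) = inj₁ (to (∈xs x) x∈xs)
  ∈⇒P⊎Q x (inj₂ x∈ys) = inj₂ (to (∈ys x) x∈ys)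
  P⊎Q⇒∈ : ∀ x → P x ⊎ Q x → x ∈ xs List.++ ys
  P⊎Q⇒∈ x (inj₁ px) = ∈-++⁺ˡ (from (∈xs x) px)
  P⊎Q⇒∈ x (inj₂ qx) = ∈-++⁺ʳ xs (from (∈ys x) qx)

HasCard-image : {A B : Set} {P : A → Set} {k : ℕ} (f : A → B) → (∀ {x y} → f x ≡ f y → x ≡ y) →
  HasCard P k → HasCard (λ y → Σ A λ x → P x × f x ≡ y) k
HasCard-image f f-inj (xs , uxs , ∈xs , lxs) =
  List.map f xs , Unique.map⁺ f-inj uxs ,
  (λ y → mk⇔ (preimage y ∘ ∈-map⁻ f) (λ { (x , px , refl) → ∈-map⁺ f (from (∈xs x) px) })) ,
  trans (length-map f xs) lxs
  where
  preimage : ∀ y → Σ _ (λ x → x ∈ xs × y ≡ f x) → Σ _ λ x → _ × f x ≡ y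
  preimage y (x , x∈xs , y≡fx) = x , to (∈xs x) x∈xs , sym y≡fx

length-cartesianProduct : {A B : Set} (xs : List A) (ys : List B) →
  length (cartesianProduct xs ys) ≡ length xs * length ys
length-cartesianProduct [] ys = refl
length-cartesianProduct (x ∷ xs) ys =
  trans (length-++ (List.map (x ,_) ys)) (cong₂ _+_ (length-map _ ys) (length-cartesianProduct xs ys))

HasCard-× : {A B : Set} {P : A → Set} {Q : B → Set} {k l : ℕ} →
  HasCard P k → HasCard Q l → HasCard (λ (xy : A × B) → P (proj₁ xy) × Q (proj₂ xy)) (k * l)
HasCard-× (xs , uxs , ∈xs , lxs) (ys , uys , ∈ys , lys) =
  cartesianProduct xs ys , Unique.cartesianProduct⁺ uxs uys ,
  (λ { (x , y) → mk⇔ (λ xy∈ → let x∈ , y∈ = ∈-cartesianProduct⁻ xs ys xy∈ in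
                                to (∈xs x) x∈ , to (∈ys y) y∈)
                     (λ { (px , qy) → ∈-cartesianProduct⁺ (from (∈xs x) px) (from (∈ys y) qy) }) }) ,
  trans (length-cartesianProduct xs ys) (cong₂ _*_ lxs lys)

++-pair-injective : ∀ {s k} {x y : Vec ℕ s × Vec ℕ k} → proj₁ x ++ proj₂ x ≡ proj₁ y ++ proj₂ y → x ≡ y
++-pair-injective {x = u , w} {u′ , w′} eq with ++-injective u u′ eq
... | refl , refl = refl

HasCard-++ : ∀ {s k a b} {P : Vec ℕ s → Set} {Q : Vec ℕ k → Set} {R : Vec ℕ (s + k) → Set} →
  (∀ u w → R (u ++ w) ⇔ (P u × Q w)) → HasCard P a → HasCard Q b → HasCard R (a * b)
HasCard-++ {s} {k} {P = P} {Q} {R} R⇔ countP countQ =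
  HasCard-resp concat⇔ (HasCard-image (λ (u , w) → u ++ w) ++-pair-injective (HasCard-× countP countQ))
  where
  concat⇔ : ∀ c → (Σ (Vec ℕ s × Vec ℕ k) λ (u , w) → (P u × Q w) × u ++ w ≡ c) ⇔ R c
  concat⇔ c = mk⇔ (λ { ((u , w) , parts , refl) → from (R⇔ u w) parts }) split
    where
    split : R c → Σ (Vec ℕ s × Vec ℕ k) λ (u , w) → (P u × Q w) × u ++ w ≡ c
    split h with splitAt s c
    ... | u , w , refl = (u , w) , to (R⇔ u w) h , refl

-- binom a b = (a + b) C a
binom : ℕ → ℕ → ℕ
binom zero b = 1
binom (suc a) zero = 1
binom (suc a) (suc b) = binom a (suc b) + binom (suc a) b

binom-zeroʳ : ∀ a → binom a 0 ≡ 1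
binom-zeroʳ zero = refl
binom-zeroʳ (suc a) = refl

binom-comm : ∀ a b → binom a b ≡ binom b a
binom-comm zero zero = refl
binom-comm zero (suc b) = refl
binom-comm (suc a) zero = refl
binom-comm (suc a) (suc b) =
  trans (cong₂ _+_ (binom-comm a (suc b)) (binom-comm (suc a) b)) (+-comm (binom (suc b) a) (binom b (suc a)))

binom-absorbˡ : ∀ a b → suc a * binom (suc a) b ≡ (suc a + b) * binom a b
binom-absorbʳ : ∀ a b → suc b * binom a (suc b) ≡ (a + suc b) * binom a b

binom-absorbˡ a zero = begin
  suc a * 1                   ≡⟨ cong₂ _*_ (sym (+-identityʳ (suc a))) (sym (binom-zeroʳ a)) ⟩
  (suc a + 0) * binom a 0     ∎
binom-absorbˡ a (suc b) = begin
  suc a * (binom a (suc b) + binom (suc a) b)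
    ≡⟨ *-distribˡ-+ (suc a) (binom a (suc b)) (binom (suc a) b) ⟩
  suc a * binom a (suc b) + suc a * binom (suc a) b
    ≡⟨ cong (suc a * binom a (suc b) +_) (binom-absorbˡ a b) ⟩
  suc a * binom a (suc b) + (suc a + b) * binom a b
    ≡⟨ cong (λ n → suc a * binom a (suc b) + n * binom a b) (+-suc a b) ⟨
  suc a * binom a (suc b) + (a + suc b) * binom a b
    ≡⟨ cong (suc a * binom a (suc b) +_) (binom-absorbʳ a b) ⟨
  suc a * binom a (suc b) + suc b * binom a (suc b)
    ≡⟨ *-distribʳ-+ (binom a (suc b)) (suc a) (suc b) ⟨
  (suc a + suc b) * binom a (suc b) ∎

binom-absorbʳ a b = begin
  suc b * binom a (suc b)     ≡⟨ cong (suc b *_) (binom-comm a (suc b)) ⟩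
  suc b * binom (suc b) a     ≡⟨ binom-absorbˡ b a ⟩
  (suc b + a) * binom b a     ≡⟨ cong₂ _*_ (+-comm (suc b) a) (binom-comm b a) ⟩
  (a + suc b) * binom a b     ∎

binom-trinomial : ∀ a b c → binom a b * binom (a + b) c ≡ binom a c * binom (a + c) b
binom-trinomial a b zero = begin
  binom a b * binom (a + b) 0      ≡⟨ cong (binom a b *_) (binom-zeroʳ (a + b)) ⟩
  binom a b * 1                    ≡⟨ *-identityʳ (binom a b) ⟩
  binom a b                        ≡⟨ cong (λ n → binom n b) (+-identityʳ a) ⟨
  binom (a + 0) b                  ≡⟨ trans (cong (_* binom (a + 0) b) (binom-zeroʳ a)) (*-identityˡ _) ⟨
  binom a 0 * binom (a + 0) b      ∎
binom-trinomial a b (suc c) = *-cancelˡ-≡ _ _ (suc c) (begin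
  suc c * (binom a b * binom (a + b) (suc c))
    ≡⟨ trans (swap (suc c) (binom a b) _) (cong (binom a b *_) (binom-absorbʳ (a + b) c)) ⟩
  binom a b * ((a + b + suc c) * binom (a + b) c)
    ≡⟨ swap (binom a b) (a + b + suc c) _ ⟩
  (a + b + suc c) * (binom a b * binom (a + b) c)
    ≡⟨ cong₂ _*_ (reorder a b c) (binom-trinomial a b c) ⟩
  (suc (a + c) + b) * (binom a c * binom (a + c) b)
    ≡⟨ swap (suc (a + c) + b) (binom a c) _ ⟩
  binom a c * ((suc (a + c) + b) * binom (a + c) b)
    ≡⟨ cong (binom a c *_) (binom-absorbˡ (a + c) b) ⟨
  binom a c * (suc (a + c) * binom (suc (a + c)) b)
    ≡⟨ cong (λ n → binom a c * (n * binom n b)) (+-suc a c) ⟨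
  binom a c * ((a + suc c) * binom (a + suc c) b)
    ≡⟨ *-assoc (binom a c) (a + suc c) (binom (a + suc c) b) ⟨
  binom a c * (a + suc c) * binom (a + suc c) b
    ≡⟨ cong (_* binom (a + suc c) b) (trans (*-comm (binom a c) (a + suc c)) (sym (binom-absorbʳ a c))) ⟩
  suc c * binom a (suc c) * binom (a + suc c) b
    ≡⟨ *-assoc (suc c) (binom a (suc c)) (binom (a + suc c) b) ⟩
  suc c * (binom a (suc c) * binom (a + suc c) b) ∎)
  where
  swap : ∀ x y z → x * (y * z) ≡ y * (x * z)
  swap = solve-∀
  reorder : ∀ a b c → a + b + suc c ≡ suc (a + c) + b
  reorder = solve-∀

ChainedOn : (ℕ → ℕ → Set) → ℕ → ℕ → {l : ℕ} → Vec ℕ l → Set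
ChainedOn R L C v = ∀ i → L < i → suc i ≤ C → R (v ! i) (v ! suc i)

BoundedOn : (ℕ → ℕ) → ℕ → ℕ → {l : ℕ} → Vec ℕ l → Set
BoundedOn f L C v = ∀ i → L < i → i ≤ C → v ! i < f i

-- lo ≤ x₁, g xᵢ ≤ xᵢ₊₁ and xᵢ < f i: for g = suc (resp. g = id) the strictly (resp. weakly)
-- increasing sequences under the bound f.
Chain : (ℕ → ℕ) → ℕ → (ℕ → ℕ) → {l : ℕ} → Vec ℕ l → Set
Chain g lo f [] = ⊤
Chain g lo f (x ∷ xs) = lo ≤ x × x < f 1 × Chain g (g x) (f ∘ suc) xs

module _ (g : ℕ → ℕ) where

  module _ (g-shift : ∀ a d → g (suc (a + d)) ≡ suc (g a + d)) where

    Chain-count : ∀ l d lo (f : ℕ → ℕ) → (∀ i → f (suc i) ≡ g (f i)) → f 1 ≡ suc (lo + d) →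
      HasCard (Chain g lo f {l}) (binom d l)
    Chain-count zero d lo f f-step f₁ =
      subst (HasCard _) (sym (binom-zeroʳ d))
        (HasCard-resp (λ { [] → mk⇔ (λ _ → _) (λ _ → refl) }) (HasCard-singleton []))
    Chain-count (suc l) zero lo f f-step f₁ =
      HasCard-resp starts-at-lo
        (HasCard-image (lo ∷_) ∷-injectiveʳ (Chain-count l zero (g lo) (f ∘ suc) (f-step ∘ suc) f₂))
      where
      f₁≡ : f 1 ≡ suc lo
      f₁≡ = trans f₁ (cong suc (+-identityʳ lo))
      f₂ : f 2 ≡ suc (g lo + 0)
      f₂ = trans (f-step 1) (trans (cong g f₁) (g-shift lo 0))
      starts-at-lo : ∀ v → (Σ (Vec ℕ l) λ xs → Chain g (g lo) (f ∘ suc) xs × lo ∷ xs ≡ v) ⇔ Chain g lo f v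
      starts-at-lo (x ∷ xs) = mk⇔
        (λ { (xs , c , refl) → ≤-refl , subst (lo <_) (sym f₁≡) ≤-refl , c })
        (λ { (lo≤x , x<f₁ , c) →
               case ≤-antisym lo≤x (≤-pred (subst (x <_) f₁≡ x<f₁)) of λ { refl → xs , c , refl } })
    Chain-count (suc l) (suc d) lo f f-step f₁ =
      HasCard-resp split (HasCard-⊎ disjoint
        (Chain-count (suc l) d (suc lo) f f-step (trans f₁ (cong suc (+-suc lo d))))
        (HasCard-image (lo ∷_) ∷-injectiveʳ (Chain-count l (suc d) (g lo) (f ∘ suc) (f-step ∘ suc) f₂)))
      where
      f₂ : f 2 ≡ suc (g lo + suc d)
      f₂ = trans (f-step 1) (trans (cong g f₁) (g-shift lo (suc d)))
      StartsAtLo : Vec ℕ (suc l) → Set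
      StartsAtLo v = Σ (Vec ℕ l) λ xs → Chain g (g lo) (f ∘ suc) xs × lo ∷ xs ≡ v
      disjoint : ∀ v → Chain g (suc lo) f v → ¬ StartsAtLo v
      disjoint (x ∷ xs) (lo<x , _) (_ , _ , refl) = n≮n lo lo<x
      split : ∀ v → (Chain g (suc lo) f v ⊎ StartsAtLo v) ⇔ Chain g lo f v
      split (x ∷ xs) = mk⇔ join cases
        where
        join : Chain g (suc lo) f (x ∷ xs) ⊎ StartsAtLo (x ∷ xs) → Chain g lo f (x ∷ xs)
        join (inj₁ (lo<x , x<f₁ , c)) = <⇒≤ lo<x , x<f₁ , c
        join (inj₂ (xs , c , refl)) = ≤-refl , subst (lo <_) (sym f₁) (s≤s (m≤m+n lo (suc d))) , c
        cases : Chain g lo f (x ∷ xs) → Chain g (suc lo) f (x ∷ xs) ⊎ StartsAtLo (x ∷ xs)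
        cases (lo≤x , x<f₁ , c) with m≤n⇒m<n∨m≡n lo≤x
        ... | inj₁ lo<x = inj₁ (lo<x , x<f₁ , c)
        ... | inj₂ refl = inj₂ (xs , c , refl)

  Chain⇔ : ∀ {l} lo f (v : Vec ℕ l) → Chain g lo f v ⇔
    ((0 < l → lo ≤ v ! 1) × ChainedOn (λ x y → g x ≤ y) 0 l v × BoundedOn f 0 l v)
  Chain⇔ lo f v = mk⇔ (fromChain lo f v) (toChain lo f v)
    where
    fromChain : ∀ {l} lo f (v : Vec ℕ l) → Chain g lo f v →
      (0 < l → lo ≤ v ! 1) × ChainedOn (λ x y → g x ≤ y) 0 l v × BoundedOn f 0 l v
    fromChain lo f [] _ = (λ ()) , (λ { i _ () }) , (λ { (suc i) _ () })
    fromChain lo f (x ∷ xs) (lo≤x , x<f₁ , c) = (λ _ → lo≤x) , chained , bounded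
      where
      rest : (0 < _ → g x ≤ xs ! 1) × ChainedOn (λ x y → g x ≤ y) 0 _ xs × BoundedOn (f ∘ suc) 0 _ xs
      rest = fromChain (g x) (f ∘ suc) xs c
      chained : ChainedOn (λ x y → g x ≤ y) 0 _ (x ∷ xs)
      chained 1 _ (s≤s l>0) = proj₁ rest l>0
      chained (suc (suc i)) _ (s≤s i<l) = proj₁ (proj₂ rest) (suc i) (s≤s z≤n) i<l
      bounded : BoundedOn f 0 _ (x ∷ xs)
      bounded 1 _ _ = x<f₁
      bounded (suc (suc i)) _ (s≤s i≤l) = proj₂ (proj₂ rest) (suc i) (s≤s z≤n) i≤l
    toChain : ∀ {l} lo f (v : Vec ℕ l) →
      (0 < l → lo ≤ v ! 1) × ChainedOn (λ x y → g x ≤ y) 0 l v × BoundedOn f 0 l v → Chain g lo f v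
    toChain lo f [] _ = _
    toChain lo f (x ∷ xs) (lo≤x , chained , bounded) =
      lo≤x (s≤s z≤n) , bounded 1 (s≤s z≤n) (s≤s z≤n) ,
      toChain (g x) (f ∘ suc) xs
        ( (λ l>0 → chained 1 (s≤s z≤n) (s≤s l>0))
        , (λ { (suc i) _ i<l → chained (suc (suc i)) (s≤s z≤n) (s≤s i<l) })
        , (λ { (suc i) _ i≤l → bounded (suc (suc i)) (s≤s z≤n) (s≤s i≤l) }))

  Chain₀⇔ : ∀ {l} f (v : Vec ℕ l) → Chain g 0 f v ⇔ (ChainedOn (λ x y → g x ≤ y) 0 l v × BoundedOn f 0 l v)
  Chain₀⇔ f v = ⇔-trans (Chain⇔ 0 f v) (mk⇔ proj₂ ((λ _ → z≤n) ,_))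

!-zero : ∀ {l} (v : Vec ℕ l) → v ! 0 ≡ 0
!-zero [] = refl
!-zero (x ∷ v) = refl

!-∷ : ∀ {l} x (v : Vec ℕ l) j → 0 < j → (x ∷ v) ! suc j ≡ v ! j
!-∷ x v (suc j) _ = refl

!-++ˡ : ∀ {s k} (u : Vec ℕ s) (w : Vec ℕ k) i → i ≤ s → (u ++ w) ! i ≡ u ! i
!-++ˡ [] w zero _ = !-zero w
!-++ˡ (x ∷ u) w zero _ = refl
!-++ˡ (x ∷ u) w 1 _ = refl
!-++ˡ (x ∷ u) w (suc (suc i)) (s≤s i<s) = !-++ˡ u w (suc i) i<s

!-++ʳ : ∀ {s k} (u : Vec ℕ s) (w : Vec ℕ k) i → 0 < i → (u ++ w) ! (s + i) ≡ w ! i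
!-++ʳ [] w i _ = refl
!-++ʳ {suc s} (x ∷ u) w i i>0 = trans (!-∷ x (u ++ w) (s + i) (≤-trans i>0 (m≤n+m i s))) (!-++ʳ u w i i>0)

!-++ʳ-suc : ∀ {s k} (u : Vec ℕ s) (w : Vec ℕ k) i → (u ++ w) ! suc (s + i) ≡ w ! suc i
!-++ʳ-suc {s} u w i = trans (cong ((u ++ w) !_) (sym (+-suc s i))) (!-++ʳ u w (suc i) (s≤s z≤n))

shift-index : ∀ s L i → s + L < i → Σ ℕ λ i′ → s + i′ ≡ i × L < i′
shift-index zero L i L<i = i , refl , L<i
shift-index (suc s) L (suc i) (s≤s s+L<i) with shift-index s L i s+L<i
... | i′ , refl , L<i′ = i′ , refl , L<i′

BoundedOn-split : ∀ {l} f L D C (v : Vec ℕ l) → L ≤ D → D ≤ C →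
  BoundedOn f L C v ⇔ (BoundedOn f L D v × BoundedOn f D C v)
BoundedOn-split f L D C v L≤D D≤C = mk⇔
  (λ h → (λ i L<i i≤D → h i L<i (≤-trans i≤D D≤C)) ,
         (λ i D<i i≤C → h i (≤-trans (s≤s L≤D) D<i) i≤C))
  (λ { (below , above) i L<i i≤C → [ below i L<i , (λ D<i → above i D<i i≤C) ]′ (≤-<-connex i D) })

module _ {s k : ℕ} (u : Vec ℕ s) (w : Vec ℕ k) where

  ChainedOn-++ˡ : ∀ R L C → C ≤ s → ChainedOn R L C (u ++ w) ⇔ ChainedOn R L C u
  ChainedOn-++ˡ R L C C≤s = mk⇔
    (λ h i L<i i<C → subst₂ R (at i i<C) (at-suc i i<C) (h i L<i i<C))
    (λ h i L<i i<C → subst₂ R (sym (at i i<C)) (sym (at-suc i i<C)) (h i L<i i<C))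
    where
    at : ∀ i → suc i ≤ C → (u ++ w) ! i ≡ u ! i
    at i i<C = !-++ˡ u w i (≤-trans (n≤1+n i) (≤-trans i<C C≤s))
    at-suc : ∀ i → suc i ≤ C → (u ++ w) ! suc i ≡ u ! suc i
    at-suc i i<C = !-++ˡ u w (suc i) (≤-trans i<C C≤s)

  ChainedOn-++ʳ : ∀ R L C → ChainedOn R (s + L) (s + C) (u ++ w) ⇔ ChainedOn R L C w
  ChainedOn-++ʳ R L C = mk⇔
    (λ h i L<i i<C → subst₂ R (!-++ʳ u w i (≤-trans (s≤s z≤n) L<i)) (!-++ʳ-suc u w i)
      (h (s + i) (+-monoʳ-< s L<i) (subst (_≤ s + C) (+-suc s i) (+-monoʳ-≤ s i<C))))
    (λ h i s+L<i i<s+C → shifted h i s+L<i i<s+C)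
    where
    shifted : ChainedOn R L C w → ChainedOn R (s + L) (s + C) (u ++ w)
    shifted h i s+L<i i<s+C with shift-index s L i s+L<i
    ... | i′ , refl , L<i′ =
      subst₂ R (sym (!-++ʳ u w i′ (≤-trans (s≤s z≤n) L<i′))) (sym (!-++ʳ-suc u w i′))
        (h i′ L<i′ (+-cancelˡ-≤ s _ _ (subst (_≤ s + C) (sym (+-suc s i′)) i<s+C)))

  BoundedOn-++ˡ : ∀ f L C → C ≤ s → BoundedOn f L C (u ++ w) ⇔ BoundedOn f L C u
  BoundedOn-++ˡ f L C C≤s = mk⇔
    (λ h i L<i i≤C → subst (_< f i) (!-++ˡ u w i (≤-trans i≤C C≤s)) (h i L<i i≤C))
    (λ h i L<i i≤C → subst (_< f i) (sym (!-++ˡ u w i (≤-trans i≤C C≤s))) (h i L<i i≤C))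

  BoundedOn-++ʳ : ∀ f L C → BoundedOn f (s + L) (s + C) (u ++ w) ⇔ BoundedOn (f ∘ (s +_)) L C w
  BoundedOn-++ʳ f L C = mk⇔
    (λ h i L<i i≤C → subst (_< f (s + i)) (!-++ʳ u w i (≤-trans (s≤s z≤n) L<i))
                                            (h (s + i) (+-monoʳ-< s L<i) (+-monoʳ-≤ s i≤C)))
    shifted
    where
    shifted : BoundedOn (f ∘ (s +_)) L C w → BoundedOn f (s + L) (s + C) (u ++ w)
    shifted h i s+L<i i≤s+C with shift-index s L i s+L<i
    ... | i′ , refl , L<i′ =
      subst (_< f (s + i′)) (sym (!-++ʳ u w i′ (≤-trans (s≤s z≤n) L<i′))) (h i′ L<i′ (+-cancelˡ-≤ s _ _ i≤s+C))

  BoundedOn-++ : ∀ f → BoundedOn f 0 (s + k) (u ++ w) ⇔ (BoundedOn f 0 s u × BoundedOn (f ∘ (s +_)) 0 k w)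
  BoundedOn-++ f = ⇔-trans (BoundedOn-split f 0 s (s + k) (u ++ w) z≤n (m≤m+n s k))
    (BoundedOn-++ˡ f 0 s ≤-refl ×-⇔ subst (λ L → BoundedOn f L (s + k) (u ++ w) ⇔ BoundedOn (f ∘ (s +_)) 0 k w)
                                           (+-identityʳ s) (BoundedOn-++ʳ f 0 k))

BoundedOn-cong : ∀ {l} {f f′ : ℕ → ℕ} {L C} {v : Vec ℕ l} → (∀ i → L < i → i ≤ C → f i ≡ f′ i) →
  BoundedOn f L C v → BoundedOn f′ L C v
BoundedOn-cong f≡f′ h i L<i i≤C = subst (_ <_) (f≡f′ i L<i i≤C) (h i L<i i≤C)

StrictUnder : (ℕ → ℕ) → {s : ℕ} → Vec ℕ s → Set
StrictUnder f {s} u = ChainedOn _<_ 0 s u × BoundedOn f 0 s u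

WeakUnder : (ℕ → ℕ) → {k : ℕ} → Vec ℕ k → Set
WeakUnder f {k} w = ChainedOn _≤_ 0 k w × BoundedOn f 0 k w

-- weakly increasing k-sequences with entries < T
#weak : ℕ → ℕ → ℕ
#weak k (suc v) = binom v k
#weak zero zero = 1
#weak (suc k) zero = 0

#I : ℕ → ℕ → ℕ → ℕ
#I s k t = binom t s * #weak k (t + s)

StrictUnder-count : ∀ s t → HasCard (StrictUnder (t +_) {s}) (binom t s)
StrictUnder-count s t = HasCard-resp (Chain₀⇔ suc (t +_))
  (Chain-count suc (λ _ _ → refl) s t 0 (t +_) (+-suc t) (trans (+-suc t 0) (cong suc (+-identityʳ t))))

WeakUnder-count : ∀ k T → HasCard (WeakUnder (λ _ → T) {k}) (#weak k T)
WeakUnder-count k (suc v) = HasCard-resp (Chain₀⇔ id (λ _ → suc v))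
  (Chain-count id (λ _ _ → refl) k v 0 (λ _ → suc v) (λ _ → refl) refl)
WeakUnder-count zero zero =
  HasCard-resp (λ { [] → mk⇔ (λ _ → (λ { i _ () }) , (λ { (suc i) _ () })) (λ _ → refl) }) (HasCard-singleton [])
WeakUnder-count (suc k) zero =
  HasCard-∅ (λ { (x ∷ w) (_ , bounded) → n≮0 (bounded 1 (s≤s z≤n) (s≤s z≤n)) })

-- ℐ(m, k, t) with the length s = m - k of the strict part as a parameter: InI m k t = InI′ m (m ∸ k) t.
InI′ : (m s t : ℕ) → Vec ℕ m → Set
InI′ m s t c = ChainedOn _<_ 0 s c × ChainedOn _≤_ s m c
              × BoundedOn (t +_) 0 s c × BoundedOn (λ _ → t + s) s m c

module _ {s k : ℕ} (t : ℕ) (u : Vec ℕ s) (w : Vec ℕ k) where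

  private
    tail⇔ : ∀ R f → (ChainedOn R s (s + k) (u ++ w) × BoundedOn f s (s + k) (u ++ w))
                    ⇔ (ChainedOn R 0 k w × BoundedOn (f ∘ (s +_)) 0 k w)
    tail⇔ R f = subst (λ L → (ChainedOn R L (s + k) (u ++ w) × BoundedOn f L (s + k) (u ++ w))
                             ⇔ (ChainedOn R 0 k w × BoundedOn (f ∘ (s +_)) 0 k w)) (+-identityʳ s)
      (ChainedOn-++ʳ u w R 0 k ×-⇔ BoundedOn-++ʳ u w f 0 k)

  InI′-++ : InI′ (s + k) s t (u ++ w) ⇔ (StrictUnder (t +_) u × WeakUnder (λ _ → t + s) w)
  InI′-++ = mk⇔
    (λ (c< , c≤ , b< , b≤) →
      (to (ChainedOn-++ˡ u w _<_ 0 s ≤-refl) c< , to (BoundedOn-++ˡ u w (t +_) 0 s ≤-refl) b<) ,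
      to (tail⇔ _≤_ (λ _ → t + s)) (c≤ , b≤))
    (λ ((c< , b<) , weak) → let c≤ , b≤ = from (tail⇔ _≤_ (λ _ → t + s)) weak in
      from (ChainedOn-++ˡ u w _<_ 0 s ≤-refl) c< , c≤ , from (BoundedOn-++ˡ u w (t +_) 0 s ≤-refl) b< , b≤)

InI′-count : ∀ s k t → HasCard (InI′ (s + k) s t) (#I s k t)
InI′-count s k t = HasCard-++ (InI′-++ t) (StrictUnder-count s t) (WeakUnder-count k (t + s))

InI-count : ∀ m k t → k ≤ m → HasCard (InI m k t) (#I (m ∸ k) k t)
InI-count m k t k≤m = count (m ∸ k) m (m∸n+n≡m k≤m)
  where
  count : ∀ s m → s + k ≡ m → HasCard (InI′ m s t) (#I s k t)
  count s .(s + k) refl = InI′-count s k t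

Box : ℕ → ℕ → List ℕ → Set
Box a b ν = IsPartition ν × length ν ≤ b × All (_≤ a) ν

head0-≤ : ∀ {a} {ν : List ℕ} → All (_≤ a) ν → head0 ν ≤ a
head0-≤ [] = z≤n
head0-≤ (x≤a ∷ _) = x≤a

All-≤-head0 : ∀ {ν : List ℕ} → Linked _≥_ ν → All (_≤ head0 ν) ν
All-≤-head0 {[]} _ = []
All-≤-head0 {_ ∷ _} lk = Linked⇒All (λ x≥y y≥z → ≤-trans y≥z x≥y) ≤-refl lk

Linked-∷ : ∀ {x} {ν : List ℕ} → All (_≤ x) ν → Linked _≥_ ν → Linked _≥_ (x ∷ ν)
Linked-∷ [] [] = [-]
Linked-∷ (y≤x ∷ _) lk = y≤x ∷ lk

Box-head< : ∀ a b ν → (Box (suc a) b ν × head0 ν < suc a) ⇔ Box a b ν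
Box-head< a b ν = mk⇔
  (λ { (((lk , pos) , len , _) , head<) →
          (lk , pos) , len , All.map (λ x≤head → ≤-trans x≤head (≤-pred head<)) (All-≤-head0 lk) })
  (λ { (part , len , ≤a) → (part , len , All.map m≤n⇒m≤1+n ≤a) , s≤s (head0-≤ ≤a) })

Box-head≡ : ∀ a b ν → (Box (suc a) (suc b) ν × head0 ν ≡ suc a)
                     ⇔ (Σ (List ℕ) λ ν′ → Box (suc a) b ν′ × suc a ∷ ν′ ≡ ν)
Box-head≡ a b ν = mk⇔ (uncurry (uncons ν))
  (λ { (ν′ , ((lk , pos) , len , ≤a) , refl) → ((Linked-∷ ≤a lk , s≤s z≤n ∷ pos) , s≤s len , ≤-refl ∷ ≤a) , refl })
  where
  uncons : ∀ ν → Box (suc a) (suc b) ν → head0 ν ≡ suc a → Σ (List ℕ) λ ν′ → Box (suc a) b ν′ × suc a ∷ ν′ ≡ ν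
  uncons (x ∷ ν′) ((lk , _ ∷ pos) , s≤s len , _ ∷ ≤a) refl = ν′ , ((Linked.tail lk , pos) , len , ≤a) , refl

Box-empty : ∀ a b → Box a b []
Box-empty a b = ([] , []) , z≤n , []

Box-zeroˡ : ∀ {b} ν → Box 0 b ν → ν ≡ []
Box-zeroˡ [] _ = refl
Box-zeroˡ (x ∷ _) ((_ , 1≤x ∷ _) , _ , x≤0 ∷ _) = ⊥-elim (1+n≰n (≤-trans 1≤x x≤0))

Box-zeroʳ : ∀ {a} ν → Box a 0 ν → ν ≡ []
Box-zeroʳ [] _ = refl
Box-zeroʳ (x ∷ _) (_ , () , _)

Box-count : ∀ a b → HasCard (Box a b) (binom a b)
Box-count zero b = HasCard-resp (λ ν → mk⇔ (λ { refl → Box-empty 0 b }) (Box-zeroˡ ν)) (HasCard-singleton [])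
Box-count (suc a) zero =
  HasCard-resp (λ ν → mk⇔ (λ { refl → Box-empty (suc a) 0 }) (Box-zeroʳ ν)) (HasCard-singleton [])
Box-count (suc a) (suc b) = HasCard-resp by-head (HasCard-⊎ disjoint
  (Box-count a (suc b)) (HasCard-image (suc a ∷_) List.∷-injectiveʳ (Box-count (suc a) b)))
  where
  HeadFull : List ℕ → Set
  HeadFull ν = Σ (List ℕ) λ ν′ → Box (suc a) b ν′ × suc a ∷ ν′ ≡ ν
  disjoint : ∀ ν → Box a (suc b) ν → ¬ HeadFull ν
  disjoint ν (_ , _ , x≤a ∷ _) (_ , _ , refl) = 1+n≰n x≤a
  by-head : ∀ ν → (Box a (suc b) ν ⊎ HeadFull ν) ⇔ Box (suc a) (suc b) ν
  by-head ν = mk⇔ [ proj₁ ∘ from (Box-head< a (suc b) ν) , proj₁ ∘ from (Box-head≡ a b ν) ]′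
    (λ box → Sum.map (λ h< → to (Box-head< a (suc b) ν) (box , h<)) (λ h≡ → to (Box-head≡ a b ν) (box , h≡))
                     (m≤n⇒m<n∨m≡n (head0-≤ (proj₂ (proj₂ box)))))

ShortBox : ℕ → ℕ → List ℕ → Set
ShortBox a b ν = IsPartition ν × suc (length ν) ≤ b × All (_≤ a) ν

#short : ℕ → ℕ → ℕ
#short a zero = 0
#short a (suc b) = binom a b

#headBelow : ℕ → ℕ → ℕ
#headBelow zero b = 0
#headBelow (suc a) b = binom a b

#headFull : ℕ → ℕ → ℕ
#headFull zero b = 1
#headFull (suc a) zero = 0
#headFull (suc a) (suc b) = binom (suc a) b

ShortBox-count : ∀ a b → HasCard (ShortBox a b) (#short a b)
ShortBox-count a zero = HasCard-∅ (λ { ν (_ , () , _) })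
ShortBox-count a (suc b) = HasCard-resp
  (λ ν → mk⇔ (λ { (part , len , ≤a) → part , s≤s len , ≤a }) (λ { (part , len , ≤a) → part , ≤-pred len , ≤a }))
  (Box-count a b)

HeadBelow-count : ∀ a b → HasCard (λ ν → Box a b ν × head0 ν < a) (#headBelow a b)
HeadBelow-count zero b = HasCard-∅ (λ { ν (_ , ()) })
HeadBelow-count (suc a) b = HasCard-resp (λ ν → ⇔-sym (Box-head< a b ν)) (Box-count a b)

HeadFull-count : ∀ a b → HasCard (λ ν → Box a b ν × head0 ν ≡ a) (#headFull a b)
HeadFull-count zero b =
  HasCard-resp (λ ν → mk⇔ (λ { refl → Box-empty 0 b , refl }) (Box-zeroˡ ν ∘ proj₁)) (HasCard-singleton [])
HeadFull-count (suc a) zero =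
  HasCard-∅ (λ { ν (box , head≡) → 0≢1+n (trans (cong head0 (sym (Box-zeroʳ ν box))) head≡) })
HeadFull-count (suc a) (suc b) = HasCard-resp (λ ν → ⇔-sym (Box-head≡ a b ν))
  (HasCard-image (suc a ∷_) List.∷-injectiveʳ (Box-count (suc a) b))

#L : ℕ → ℕ → ℕ → ℕ → ℕ
#L m s k t = binom m t * #headBelow s k + #short m t * #headFull s k

InL-count : ∀ m k t → HasCard (InL m k t) (#L m (m ∸ k) k t)
InL-count m k t = HasCard-resp by-head (HasCard-⊎ disjoint
  (HasCard-× (Box-count m t) (HeadBelow-count s k)) (HasCard-× (ShortBox-count m t) (HeadFull-count s k)))
  where
  s = m ∸ k
  Below Full : List ℕ × List ℕ → Set
  Below (λ′ , ν) = Box m t λ′ × Box s k ν × head0 ν < s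
  Full (λ′ , ν) = ShortBox m t λ′ × Box s k ν × head0 ν ≡ s
  disjoint : ∀ p → Below p → ¬ Full p
  disjoint _ (_ , _ , head<) (_ , _ , head≡) = <-irrefl head≡ head<
  by-head : ∀ p → (Below p ⊎ Full p) ⇔ InL m k t p
  by-head (λ′ , ν) = mk⇔
    (λ { (inj₁ ((partλ , lenλ , ≤m) , (partν , lenν , ≤s) , head<)) →
           partλ , partν , lenν , ≤s , ≤m , (λ _ → lenλ) , (λ head≡ → ⊥-elim (<-irrefl head≡ head<))
       ; (inj₂ ((partλ , lenλ , ≤m) , (partν , lenν , ≤s) , head≡)) →
           partλ , partν , lenν , ≤s , ≤m , (λ head< → ⊥-elim (<-irrefl head≡ head<)) , (λ _ → lenλ) })
    (λ (partλ , partν , lenν , ≤s , ≤m , if< , if≡) →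
       Sum.map (λ head< → (partλ , if< head< , ≤m) , (partν , lenν , ≤s) , head<)
               (λ head≡ → (partλ , if≡ head≡ , ≤m) , (partν , lenν , ≤s) , head≡)
               (m≤n⇒m<n∨m≡n (head0-≤ ≤s)))

-- Both sides times (a + 1)(a + b + 2) are multiples of X = binom a k * binom (a + k) t,
-- by absorption and the trinomial revision binom a t * binom (a + t) k ≡ X.
binom-identity : ∀ a b c →
  binom (suc c) (suc a) * binom (c + suc a) (suc b)
    ≡ binom (suc a + suc b) (suc c) * binom a (suc b) + binom (suc a + suc b) c * binom (suc a) b
binom-identity a b c = *-cancelˡ-≡ lhs rhs (s * sk) (begin
  s * sk * lhs                             ≡⟨ reassoc s sk lhs ⟩
  sk * (s * lhs)                           ≡⟨ cong (sk *_) lhs-scaled ⟩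
  sk * ((s + t) * X)                       ≡⟨ distribute a b c (binom a k) (binom (a + k) t) ⟩
  s * ((sk + t) * X) + (k * binom a k) * (t * binom (a + k) t)
    ≡⟨ cong₂ (λ x y → s * x + y) first-scaled (cong₂ _*_ (absorb-both a b) (absorb-both (a + k) c)) ⟨
  s * (sk * first) + (s * binom s b) * (sk * binom sk c)
    ≡⟨ collect s sk first (binom s b) (binom sk c) ⟩
  s * sk * rhs                             ∎)
  where
  s k t sk X lhs first rhs : ℕ
  s = suc a
  k = suc b
  t = suc c
  sk = suc (a + k)
  X = binom a k * binom (a + k) t
  lhs = binom t s * binom (c + s) k
  first = binom sk t * binom a k
  rhs = first + binom sk c * binom s b

  reassoc : ∀ x y z → x * y * z ≡ y * (x * z)
  reassoc = solve-∀
  rotate : ∀ x y z → x * y * z ≡ x * (z * y)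
  rotate = solve-∀
  distribute : ∀ a b c u v → suc (a + suc b) * ((suc a + suc c) * (u * v))
      ≡ suc a * ((suc (a + suc b) + suc c) * (u * v)) + (suc b * u) * (suc c * v)
  distribute = solve-∀
  collect : ∀ x y g u v → x * (y * g) + (x * u) * (y * v) ≡ x * y * (g + v * u)
  collect = solve-∀

  absorb-both : ∀ x y → suc x * binom (suc x) y ≡ suc y * binom x (suc y)
  absorb-both x y = begin
    suc x * binom (suc x) y   ≡⟨ binom-absorbˡ x y ⟩
    (suc x + y) * binom x y   ≡⟨ cong (_* binom x y) (+-suc x y) ⟨
    (x + suc y) * binom x y   ≡⟨ binom-absorbʳ x y ⟨
    suc y * binom x (suc y)   ∎

  lhs-scaled : s * lhs ≡ (s + t) * X
  lhs-scaled = begin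
    s * (binom t s * binom (c + s) k)        ≡⟨ *-assoc s (binom t s) _ ⟨
    s * binom t s * binom (c + s) k          ≡⟨ cong₂ (λ x y → s * x * binom y k) (binom-comm t s) (+-comm c s) ⟩
    s * binom s t * binom (s + c) k          ≡⟨ cong (λ y → s * binom s t * binom y k) (+-suc a c) ⟨
    s * binom s t * binom (a + t) k          ≡⟨ cong (_* binom (a + t) k) (binom-absorbˡ a t) ⟩
    (s + t) * binom a t * binom (a + t) k    ≡⟨ *-assoc (s + t) (binom a t) _ ⟩
    (s + t) * (binom a t * binom (a + t) k)  ≡⟨ cong ((s + t) *_) (binom-trinomial a t k) ⟩
    (s + t) * X                              ∎
  first-scaled : sk * first ≡ (sk + t) * X
  first-scaled = begin
    sk * (binom sk t * binom a k)            ≡⟨ *-assoc sk (binom sk t) (binom a k) ⟨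
    sk * binom sk t * binom a k              ≡⟨ cong (_* binom a k) (binom-absorbˡ (a + k) t) ⟩
    (sk + t) * binom (a + k) t * binom a k   ≡⟨ rotate (sk + t) (binom (a + k) t) (binom a k) ⟩
    (sk + t) * X                             ∎

#weak-zeroˡ : ∀ T → #weak 0 T ≡ 1
#weak-zeroˡ zero = refl
#weak-zeroˡ (suc T) = binom-zeroʳ T

-- Fails for s = k = t = 0: ℐ(0,0,0) holds the empty sequence while ℒ(0,0,0) is empty (χ = -1).
#I≡#L : ∀ s k t → 0 < s + k → #I s k t ≡ #L (s + k) s k t
#I≡#L zero (suc b) zero _ = refl
#I≡#L zero (suc b) (suc c) _ = begin
  binom (c + 0) (suc b) + 0         ≡⟨ +-identityʳ _ ⟩
  binom (c + 0) (suc b)             ≡⟨ cong (λ n → binom n (suc b)) (+-identityʳ c) ⟩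
  binom c (suc b)                   ≡⟨ binom-comm c (suc b) ⟩
  binom (suc b) c                   ≡⟨ *-identityʳ _ ⟨
  binom (suc b) c * 1               ≡⟨ cong (_+ binom (suc b) c * 1) (*-zeroʳ (binom (suc b) (suc c))) ⟨
  binom (suc b) (suc c) * 0 + binom (suc b) c * 1 ∎
#I≡#L (suc a) zero t _ = begin
  binom t (suc a) * #weak 0 (t + suc a)     ≡⟨ cong (binom t (suc a) *_) (#weak-zeroˡ (t + suc a)) ⟩
  binom t (suc a) * 1                       ≡⟨ *-identityʳ _ ⟩
  binom t (suc a)                           ≡⟨ binom-comm t (suc a) ⟩
  binom (suc a) t                           ≡⟨ cong (λ n → binom n t) (+-identityʳ (suc a)) ⟨
  binom (suc a + 0) t                       ≡⟨ *-identityʳ _ ⟨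
  binom (suc a + 0) t * 1                   ≡⟨ cong (binom (suc a + 0) t *_) (binom-zeroʳ a) ⟨
  binom (suc a + 0) t * binom a 0           ≡⟨ +-identityʳ _ ⟨
  binom (suc a + 0) t * binom a 0 + 0
    ≡⟨ cong (binom (suc a + 0) t * binom a 0 +_) (*-zeroʳ (#short (suc a + 0) t)) ⟨
  binom (suc a + 0) t * binom a 0 + #short (suc a + 0) t * 0 ∎
#I≡#L (suc a) (suc b) zero _ = sym (+-identityʳ _)
#I≡#L (suc a) (suc b) (suc c) _ = binom-identity a b c

#I≡#L-∸ : ∀ m k t → k ≤ m → 0 < m → #I (m ∸ k) k t ≡ #L m (m ∸ k) k t
#I≡#L-∸ m k t k≤m 0<m =
  trans (#I≡#L (m ∸ k) k t (subst (0 <_) (sym m∸k+k≡m) 0<m)) (cong (λ n → #L n (m ∸ k) k t) m∸k+k≡m)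
  where
  m∸k+k≡m : m ∸ k + k ≡ m
  m∸k+k≡m = m∸n+n≡m k≤m

psum-zero : ∀ {p} (v : Vec ℕ p) → psum v 0 ≡ 0
psum-zero [] = refl
psum-zero (x ∷ v) = refl

psum-suc : ∀ {p} (v : Vec ℕ p) (j : Fin p) → psum v (suc (toℕ j)) ≡ psum v (toℕ j) + lookup v j
psum-suc (x ∷ v) fzero = trans (cong (x +_) (psum-zero v)) (+-identityʳ x)
psum-suc (x ∷ v) (fsuc j) = trans (cong (x +_) (psum-suc v j)) (sym (+-assoc x _ _))

psum-mono : ∀ {p} (v : Vec ℕ p) {a b} → a ≤ b → psum v a ≤ psum v b
psum-mono [] _ = ≤-refl
psum-mono (x ∷ v) {zero} _ = z≤n
psum-mono (x ∷ v) {suc a} {suc b} (s≤s a≤b) = +-monoʳ-≤ x (psum-mono v a≤b)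

tt-zero : ∀ {p} (μ γ : Vec ℕ p) → tt μ γ 0 ≡ 0
tt-zero μ γ = psum-zero (zipWith _∸_ μ γ)

tt-suc : ∀ {p} (μ γ : Vec ℕ p) (j : Fin p) → tt μ γ (suc (toℕ j)) ≡ tt μ γ (toℕ j) + (lookup μ j ∸ lookup γ j)
tt-suc μ γ j = trans (psum-suc (zipWith _∸_ μ γ) j) (cong (tt μ γ (toℕ j) +_) (lookup-zipWith _∸_ j μ γ))

<ᵇ-false : ∀ {a b} → b ≤ a → (a <ᵇ b) ≡ false
<ᵇ-false {a} {b} b≤a with a <ᵇ b in a<ᵇb
... | false = refl
... | true = ⊥-elim (<⇒≱ (<ᵇ⇒< a b (from T-≡ a<ᵇb)) b≤a)

any-allFin-unique : ∀ {p} (F : Fin p → Bool) (j : Fin p) → (∀ j′ → T (F j′) → j′ ≡ j) → any F (allFin p) ≡ F j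
any-allFin-unique {p} F j unique with F j in Fj | any F (allFin p) in anyF
... | true | true = refl
... | false | false = refl
... | true | false = ⊥-elim (subst T anyF (any⁺ F (Any.map (λ { refl → from T-≡ Fj }) (∈-allFin j))))
... | false | true with satisfied (any⁻ F (allFin p) (from T-≡ anyF))
...   | j′ , Fj′ with unique j′ Fj′
...     | refl = ⊥-elim (subst T Fj Fj′)

st-suc-∈ : ∀ (Jm : ℕ → Bool) {i} → Jm (suc i) ≡ true → st Jm (suc i) ≡ st Jm i
st-suc-∈ Jm {i} i∈J rewrite i∈J = refl

st-suc-∉ : ∀ (Jm : ℕ → Bool) {i} → Jm (suc i) ≡ false → st Jm (suc i) ≡ suc (st Jm i)
st-suc-∉ Jm {i} i∉J rewrite i∉J = refl

module _ {p} (μ γ : Vec ℕ p) (γ≤μ : ∀ j → lookup γ j ≤ lookup μ j) where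

  private
    Mⱼ sⱼ tⱼ : Fin p → ℕ
    Mⱼ j = M μ (toℕ j)
    sⱼ j = lookup μ j ∸ lookup γ j
    tⱼ j = tt μ γ (toℕ j)
    stJ : ℕ → ℕ
    stJ = st (J μ γ)

  M-split : (j : Fin p) → M μ (suc (toℕ j)) ∸ lookup γ j ≡ Mⱼ j + sⱼ j
  M-split j = trans (cong (_∸ lookup γ j) (psum-suc μ j)) (+-∸-assoc (Mⱼ j) (γ≤μ j))

  J-in-block : (j : Fin p) → ∀ i → Mⱼ j < i → i ≤ M μ (suc (toℕ j)) → J μ γ i ≡ (Mⱼ j + sⱼ j <ᵇ i)
  J-in-block j i M<i i≤M = begin
    any F (allFin p)                                        ≡⟨ any-allFin-unique F j only-j ⟩
    (M μ (suc (toℕ j)) ∸ lookup γ j <ᵇ i) ∧ (i ≤ᵇ M μ (suc (toℕ j)))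
      ≡⟨ cong ((M μ (suc (toℕ j)) ∸ lookup γ j <ᵇ i) ∧_) (to T-≡ (≤⇒≤ᵇ i≤M)) ⟩
    (M μ (suc (toℕ j)) ∸ lookup γ j <ᵇ i) ∧ true            ≡⟨ ∧-identityʳ _ ⟩
    (M μ (suc (toℕ j)) ∸ lookup γ j <ᵇ i)                   ≡⟨ cong (_<ᵇ i) (M-split j) ⟩
    (Mⱼ j + sⱼ j <ᵇ i)                                      ∎
    where
    F : Fin p → Bool
    F j′ = ((M μ (suc (toℕ j′)) ∸ lookup γ j′) <ᵇ i) ∧ (i ≤ᵇ M μ (suc (toℕ j′)))
    only-j : ∀ j′ → T (F j′) → j′ ≡ j
    only-j j′ Fj′ with to T-∧ Fj′
    ... | lo , hi with <-cmp (toℕ j′) (toℕ j)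
    ...   | tri≈ _ j′≡j _ = toℕ-injective j′≡j
    ...   | tri< j′<j _ _ = ⊥-elim (<⇒≱ M<i (≤-trans (≤ᵇ⇒≤ i _ hi) (psum-mono μ j′<j)))
    ...   | tri> _ _ j′>j = ⊥-elim (<⇒≱ (<ᵇ⇒< _ i lo)
      (≤-trans i≤M (≤-trans (psum-mono μ j′>j) (≤-trans (m≤m+n _ _) (≤-reflexive (sym (M-split j′)))))))

  st-block : (j : Fin p) → stJ (Mⱼ j) ≡ tⱼ j → ∀ r → r ≤ lookup μ j → stJ (Mⱼ j + r) ≡ tⱼ j + (r ⊓ sⱼ j)
  st-block j start zero _ = trans (cong stJ (+-identityʳ (Mⱼ j))) (trans start (sym (+-identityʳ _)))
  st-block j start (suc r) r<μ = trans (cong stJ (+-suc (Mⱼ j) r)) (step (≤-<-connex (sⱼ j) r))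
    where
    previous : stJ (Mⱼ j + r) ≡ tⱼ j + (r ⊓ sⱼ j)
    previous = st-block j start r (<⇒≤ r<μ)
    r+1-in-block : suc (Mⱼ j + r) ≤ M μ (suc (toℕ j))
    r+1-in-block = ≤-trans (≤-reflexive (sym (+-suc (Mⱼ j) r)))
                           (≤-trans (+-monoʳ-≤ (Mⱼ j) r<μ) (≤-reflexive (sym (psum-suc μ j))))
    J-here : J μ γ (suc (Mⱼ j + r)) ≡ (Mⱼ j + sⱼ j <ᵇ suc (Mⱼ j + r))
    J-here = J-in-block j (suc (Mⱼ j + r)) (s≤s (m≤m+n (Mⱼ j) r)) r+1-in-block
    step : sⱼ j ≤ r ⊎ r < sⱼ j → stJ (suc (Mⱼ j + r)) ≡ tⱼ j + (suc r ⊓ sⱼ j)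
    step (inj₁ s≤r) = begin
      stJ (suc (Mⱼ j + r))       ≡⟨ st-suc-∈ (J μ γ) (trans J-here (to T-≡ (<⇒<ᵇ (s≤s (+-monoʳ-≤ (Mⱼ j) s≤r))))) ⟩
      stJ (Mⱼ j + r)             ≡⟨ previous ⟩
      tⱼ j + (r ⊓ sⱼ j)          ≡⟨ cong (tⱼ j +_) (m≥n⇒m⊓n≡n s≤r) ⟩
      tⱼ j + sⱼ j                ≡⟨ cong (tⱼ j +_) (m≥n⇒m⊓n≡n (m≤n⇒m≤1+n s≤r)) ⟨
      tⱼ j + (suc r ⊓ sⱼ j)      ∎
    step (inj₂ r<s) = begin
      stJ (suc (Mⱼ j + r))       ≡⟨ st-suc-∉ (J μ γ) (trans J-here (<ᵇ-false (≤-trans r+1≤ (+-monoʳ-≤ (Mⱼ j) r<s)))) ⟩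
      suc (stJ (Mⱼ j + r))       ≡⟨ cong suc previous ⟩
      suc (tⱼ j + (r ⊓ sⱼ j))    ≡⟨ cong (λ n → suc (tⱼ j + n)) (m≤n⇒m⊓n≡m (<⇒≤ r<s)) ⟩
      suc (tⱼ j + r)             ≡⟨ +-suc (tⱼ j) r ⟨
      tⱼ j + suc r               ≡⟨ cong (tⱼ j +_) (m≤n⇒m⊓n≡m r<s) ⟨
      tⱼ j + (suc r ⊓ sⱼ j)      ∎
      where
      r+1≤ : suc (Mⱼ j + r) ≤ Mⱼ j + suc r
      r+1≤ = ≤-reflexive (sym (+-suc (Mⱼ j) r))

  st-block-end : (j : Fin p) → stJ (Mⱼ j) ≡ tⱼ j → stJ (M μ (suc (toℕ j))) ≡ tt μ γ (suc (toℕ j))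
  st-block-end j start = begin
    stJ (M μ (suc (toℕ j)))              ≡⟨ cong stJ (psum-suc μ j) ⟩
    stJ (Mⱼ j + lookup μ j)              ≡⟨ st-block j start (lookup μ j) ≤-refl ⟩
    tⱼ j + (lookup μ j ⊓ sⱼ j)           ≡⟨ cong (tⱼ j +_) (m≥n⇒m⊓n≡n (m∸n≤m (lookup μ j) (lookup γ j))) ⟩
    tⱼ j + sⱼ j                          ≡⟨ tt-suc μ γ j ⟨
    tt μ γ (suc (toℕ j))                 ∎

  st-block-start : ∀ n → n ≤ p → stJ (M μ n) ≡ tt μ γ n
  st-block-start zero _ = trans (cong stJ (psum-zero μ)) (sym (tt-zero μ γ))
  st-block-start (suc n) n<p = subst (λ m → stJ (M μ (suc m)) ≡ tt μ γ (suc m)) (toℕ-fromℕ< n<p)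
    (st-block-end (fromℕ< n<p)
      (subst (λ m → stJ (M μ m) ≡ tt μ γ m) (sym (toℕ-fromℕ< n<p)) (st-block-start n (<⇒≤ n<p))))

  st-in-block : (j : Fin p) → ∀ r → r ≤ lookup μ j →
    st (J μ γ) (M μ (toℕ j) + r) ≡ tt μ γ (toℕ j) + (r ⊓ (lookup μ j ∸ lookup γ j))
  st-in-block j = st-block j (st-block-start (toℕ j) (<⇒≤ (toℕ<n j)))

BlockChained : ∀ {p} (μ γ : Vec ℕ p) {n} → Vec ℕ n → Fin p → Set
BlockChained μ γ a j = ChainedOn _<_ (M μ (toℕ j)) (M μ (suc (toℕ j)) ∸ lookup γ j) a
                     × ChainedOn _≤_ (M μ (suc (toℕ j)) ∸ lookup γ j) (M μ (suc (toℕ j))) a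

Blocked : ∀ {p} → (ℕ → ℕ) → Vec ℕ p → Vec ℕ p → {n : ℕ} → Vec ℕ n → Set
Blocked β μ γ {n} a = BoundedOn β 0 n a × (∀ j → BlockChained μ γ a j)

InA⇔Blocked : ∀ {p} (μ γ : Vec ℕ p) {n} (a : Vec ℕ n) → InA μ γ a ⇔ Blocked (st (J μ γ)) μ γ a
InA⇔Blocked μ γ a = mk⇔ (λ (b , c< , c≤) → b , λ j → c< j , c≤ j) (λ (b , c) → b , proj₁ ∘ c , proj₂ ∘ c)

module _ {p x g : ℕ} (μ γ : Vec ℕ p) (β : ℕ → ℕ) (T₀ : ℕ)
         (γ≤μ : ∀ j → lookup (g ∷ γ) j ≤ lookup (x ∷ μ) j)
         (first-bound : ∀ r → 0 < r → r ≤ x → β r ≡ T₀ + (r ⊓ (x ∸ g)))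
         (u : Vec ℕ x) (w : Vec ℕ (psum μ p)) where

  private
    s : ℕ
    s = x ∸ g

    first-block : BlockChained (x ∷ μ) (g ∷ γ) (u ++ w) fzero ⇔ (ChainedOn _<_ 0 s u × ChainedOn _≤_ s x u)
    first-block = subst (λ y → (ChainedOn _<_ 0 (y ∸ g) (u ++ w) × ChainedOn _≤_ (y ∸ g) y (u ++ w))
                               ⇔ (ChainedOn _<_ 0 s u × ChainedOn _≤_ s x u))
      (sym (trans (cong (x +_) (psum-zero μ)) (+-identityʳ x)))
      (ChainedOn-++ˡ u w _<_ 0 s (m∸n≤m x g) ×-⇔ ChainedOn-++ˡ u w _≤_ s x ≤-refl)

    later-block : ∀ j → BlockChained (x ∷ μ) (g ∷ γ) (u ++ w) (fsuc j) ⇔ BlockChained μ γ w j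
    later-block j = subst (λ y → (ChainedOn _<_ (x + M μ (toℕ j)) y (u ++ w)
                                  × ChainedOn _≤_ y (x + M μ (suc (toℕ j))) (u ++ w)) ⇔ BlockChained μ γ w j)
      (sym (+-∸-assoc x γⱼ≤M))
      (ChainedOn-++ʳ u w _<_ (M μ (toℕ j)) (M μ (suc (toℕ j)) ∸ lookup γ j)
        ×-⇔ ChainedOn-++ʳ u w _≤_ (M μ (suc (toℕ j)) ∸ lookup γ j) (M μ (suc (toℕ j))))
      where
      γⱼ≤M : lookup γ j ≤ M μ (suc (toℕ j))
      γⱼ≤M = ≤-trans (γ≤μ (fsuc j)) (≤-trans (m≤n+m _ _) (≤-reflexive (sym (psum-suc μ j))))

    first-bounds : BoundedOn β 0 x u ⇔ (BoundedOn (T₀ +_) 0 s u × BoundedOn (λ _ → T₀ + s) s x u)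
    first-bounds = ⇔-trans (BoundedOn-split β 0 s x u z≤n (m∸n≤m x g)) (mk⇔
      (λ (below , above) → BoundedOn-cong {v = u} strict-part below , BoundedOn-cong {v = u} weak-part above)
      (λ (below , above) → BoundedOn-cong {v = u} (λ i 0<i i≤s → sym (strict-part i 0<i i≤s)) below ,
                           BoundedOn-cong {v = u} (λ i s<i i≤x → sym (weak-part i s<i i≤x)) above))
      where
      strict-part : ∀ i → 0 < i → i ≤ s → β i ≡ T₀ + i
      strict-part i 0<i i≤s = trans (first-bound i 0<i (≤-trans i≤s (m∸n≤m x g))) (cong (T₀ +_) (m≤n⇒m⊓n≡m i≤s))
      weak-part : ∀ i → s < i → i ≤ x → β i ≡ T₀ + s
      weak-part i s<i i≤x = trans (first-bound i (≤-trans (s≤s z≤n) s<i) i≤x) (cong (T₀ +_) (m≥n⇒m⊓n≡n (<⇒≤ s<i)))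

  Blocked-++ : Blocked β (x ∷ μ) (g ∷ γ) (u ++ w) ⇔ (InI x g T₀ u × Blocked (β ∘ (x +_)) μ γ w)
  Blocked-++ = mk⇔
    (λ (b , c) → let (b< , b≤) , bw = to bounds b ; c< , c≤ = to first-block (c fzero) in
      (c< , c≤ , b< , b≤) , bw , (λ j → to (later-block j) (c (fsuc j))))
    (λ ((c< , c≤ , b< , b≤) , bw , cw) →
      from bounds ((b< , b≤) , bw) , ∀-cons (from first-block (c< , c≤)) (λ j → from (later-block j) (cw j)))
    where
    bounds : BoundedOn β 0 (x + psum μ p) (u ++ w)
             ⇔ ((BoundedOn (T₀ +_) 0 s u × BoundedOn (λ _ → T₀ + s) s x u) × BoundedOn (β ∘ (x +_)) 0 (psum μ p) w)
    bounds = ⇔-trans (BoundedOn-++ u w β) (first-bounds ×-⇔ ⇔-refl)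

prodFin-suc : ∀ p (f : Fin (suc p) → ℕ) → prodFin (suc p) f ≡ f fzero * prodFin p (f ∘ fsuc)
prodFin-suc p f =
  cong ((f fzero *_) ∘ product) (trans (List.map-tabulate fsuc f) (sym (List.map-tabulate id (f ∘ fsuc))))

prodFin-cong : ∀ p {f g : Fin p → ℕ} → (∀ j → f j ≡ g j) → prodFin p f ≡ prodFin p g
prodFin-cong p f≗g = cong product (List.map-cong f≗g (allFin p))

BlockBound : ∀ {p} → (ℕ → ℕ) → ℕ → Vec ℕ p → Vec ℕ p → Set
BlockBound β T₀ μ γ = ∀ j r → 0 < r → r ≤ lookup μ j →
  β (M μ (toℕ j) + r) ≡ T₀ + (tt μ γ (toℕ j) + (r ⊓ (lookup μ j ∸ lookup γ j)))

#Iblocks : ∀ {p} → Vec ℕ p → Vec ℕ p → ℕ → Fin p → ℕ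
#Iblocks μ γ T₀ j = #I (lookup μ j ∸ lookup γ j) (lookup γ j) (T₀ + tt μ γ (toℕ j))

Blocked-count : ∀ {p} (μ γ : Vec ℕ p) β T₀ → (∀ j → lookup γ j ≤ lookup μ j) → BlockBound β T₀ μ γ →
  HasCard (Blocked β μ γ {psum μ p}) (prodFin p (#Iblocks μ γ T₀))
Blocked-count [] [] β T₀ _ _ =
  HasCard-resp (λ { [] → mk⇔ (λ _ → (λ { (suc i) _ () }) , (λ ())) (λ _ → refl) }) (HasCard-singleton [])
Blocked-count {suc p} (x ∷ μ) (g ∷ γ) β T₀ γ≤μ bound =
  subst (HasCard _) count≡ (HasCard-++ (Blocked-++ μ γ β T₀ γ≤μ (bound fzero))
    (InI-count x g T₀ (γ≤μ fzero)) (Blocked-count μ γ (β ∘ (x +_)) (T₀ + (x ∸ g)) (γ≤μ ∘ fsuc) tail-bound))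
  where
  regroup : ∀ a b c d → a + ((b + c) + d) ≡ (a + b) + (c + d)
  regroup = solve-∀
  tail-bound : BlockBound (β ∘ (x +_)) (T₀ + (x ∸ g)) μ γ
  tail-bound j r 0<r r≤μ =
    trans (cong β (sym (+-assoc x _ r))) (trans (bound (fsuc j) r 0<r r≤μ) (regroup T₀ (x ∸ g) _ _))
  count≡ : #I (x ∸ g) g T₀ * prodFin p (#Iblocks μ γ (T₀ + (x ∸ g))) ≡ prodFin (suc p) (#Iblocks (x ∷ μ) (g ∷ γ) T₀)
  count≡ = sym (trans (prodFin-suc p (#Iblocks (x ∷ μ) (g ∷ γ) T₀))
    (cong₂ _*_ (cong (#I (x ∸ g) g) (+-identityʳ T₀))
               (prodFin-cong p (λ j → cong (#I (lookup μ j ∸ lookup γ j) (lookup γ j)) (sym (+-assoc T₀ (x ∸ g) _))))))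

lemma4p18 : {p n : ℕ} (μ γ : Vec ℕ p) → μ ⊢ n
    → (∀ (j : Fin p) → lookup γ j ≤ lookup μ j)
    → (∀ (j : Fin p) (r : ℕ) → 1 ≤ r → r ≤ lookup μ j
         → (r ≤ lookup μ j ∸ lookup γ j
              → st (J μ γ) (M μ (toℕ j) + r) ≡ tt μ γ (toℕ j) + r)
           × (lookup μ j ∸ lookup γ j < r
              → st (J μ γ) (M μ (toℕ j) + r) ≡ tt μ γ (suc (toℕ j))))
      × Σ (Fin p → ℕ) (λ cI → Σ (Fin p → ℕ) (λ cL →
          (∀ (j : Fin p) → HasCard (InI (lookup μ j) (lookup γ j) (tt μ γ (toℕ j))) (cI j))
          × (∀ (j : Fin p) → HasCard (InL (lookup μ j) (lookup γ j) (tt μ γ (toℕ j))) (cL j))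
          × HasCard (InA μ γ {n}) (prodFin p cI)
          × prodFin p cI ≡ prodFin p cL))
lemma4p18 {p} μ γ ((_ , positive) , refl) γ≤μ =
  st-shape , #Iblocks μ γ 0 , cL ,
  (λ j → InI-count (lookup μ j) (lookup γ j) (tt μ γ (toℕ j)) (γ≤μ j)) ,
  (λ j → InL-count (lookup μ j) (lookup γ j) (tt μ γ (toℕ j))) ,
  HasCard-resp (λ a → ⇔-sym (InA⇔Blocked μ γ a))
    (Blocked-count μ γ (st (J μ γ)) 0 γ≤μ (λ j r _ → st-in-block μ γ γ≤μ j r)) ,
  prodFin-cong p (λ j → #I≡#L-∸ (lookup μ j) (lookup γ j) (tt μ γ (toℕ j)) (γ≤μ j) (lookup⁺ (toList⁻ positive) j))
  where
  cL : Fin p → ℕ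
  cL j = #L (lookup μ j) (lookup μ j ∸ lookup γ j) (lookup γ j) (tt μ γ (toℕ j))
  st-shape : ∀ j r → 1 ≤ r → r ≤ lookup μ j →
    (r ≤ lookup μ j ∸ lookup γ j → st (J μ γ) (M μ (toℕ j) + r) ≡ tt μ γ (toℕ j) + r)
    × (lookup μ j ∸ lookup γ j < r → st (J μ γ) (M μ (toℕ j) + r) ≡ tt μ γ (suc (toℕ j)))
  st-shape j r _ r≤μ =
    (λ r≤s → trans (st-in-block μ γ γ≤μ j r r≤μ) (cong (tt μ γ (toℕ j) +_) (m≤n⇒m⊓n≡m r≤s))) ,
    (λ s<r → trans (st-in-block μ γ γ≤μ j r r≤μ)
                   (trans (cong (tt μ γ (toℕ j) +_) (m≥n⇒m⊓n≡n (<⇒≤ s<r))) (sym (tt-suc μ γ j))))
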